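{- Let $G_1,G_2$ be finite simple graphs, where $G_i$ has order $n_i$, minimum degree $\delta_i$ and maximum degree $\Delta_i$, $i\in\{1,2\}$. Let $k_i\in\{2-\Delta_i,\dots,\Delta_i\}$ be integers and let $k'=\max\{k_1-\delta_2,\,k_2-\delta_1,\,\min\{k_2+\Delta_1,k_1+\Delta_2\}\}$. Then for every integer $k\in\{k',\dots,\Delta_1+\Delta_2\}$, $$\phi_k^o(G_1\times G_2)\ge n_1\phi^o_{k_2}(G_2)+n_2\phi^o_{k_1}(G_1)-\phi^o_{k_1}(G_1)\phi^o_{k_2}(G_2).$$
   Context: For a graph $G=(V,E)$, a set $S\subseteq V$ and $v\in V$, $\delta_S(v)=|\{u\in S: uv\in E\}|$, $\overline{S}=V\setminus S$, and $\partial S$ is the set of vertices of $\overline{S}$ adjacent to at least one vertex of $S$. For an integer $k$, a non-empty set $S\subseteq V$ is an offensive $k$-alliance if $\delta_S(v)\ge \delta_{\overline{S}}(v)+k$ for every $v\in \partial S$. A set $X\subseteq V$ is offensive $k$-alliance free ($k$-oaf) if $X$ contains no offensive $k$-alliance as a subset; $\phi_k^o(G)$ is the maximum cardinality of a $k$-oaf set in $G$. The Cartesian product $G_1\times G_2$ has vertex set $V_1\times V_2$, with $(a,b)$ adjacent to $(c,d)$ iff either $a=c$ and $bd\in E_2$, or $b=d$ and $ac\in E_1$. -}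

module Defs where

open import Data.Nat as ℕ using (ℕ; zero; suc; _⊔_; _⊓_)
open import Data.Integer as ℤ using (ℤ; +_)
open import Data.Bool using (Bool; true; false; _∧_; _∨_; not)
open import Data.Fin using (Fin; zero; suc; remQuot; _≟_)
open import Data.Product using (Σ; _×_; _,_; proj₁; proj₂; ∃)
open import Relation.Nullary using (¬_)
open import Relation.Nullary.Decidable using (⌊_⌋)
open import Relation.Binary.PropositionalEquality using (_≡_)

record Graph : Set where
  field
    n   : ℕ
    adj : Fin n → Fin n → Bool
open Graph public

IsSimple : Graph → Set
IsSimple G = (∀ u v → adj G u v ≡ adj G v u) × (∀ v → adj G v v ≡ false)

b2n : Bool → ℕ
b2n true  = 1
b2n false = 0

count : ∀ {n} → (Fin n → Bool) → ℕ
count {zero}  p = 0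
count {suc n} p = b2n (p zero) ℕ.+ count (λ i → p (suc i))

maxF : ∀ {n} → (Fin n → ℕ) → ℕ
maxF {zero}  f = 0
maxF {suc n} f = f zero ⊔ maxF (λ i → f (suc i))

-- (value 0 on the empty graph; irrelevant there)
minF : ∀ {n} → (Fin n → ℕ) → ℕ
minF {zero}        f = 0
minF {suc zero}    f = f zero
minF {suc (suc n)} f = f zero ⊓ minF (λ i → f (suc i))

VSet : Graph → Set
VSet G = Fin (n G) → Bool

deg : (G : Graph) → Fin (n G) → ℕ
deg G v = count (λ u → adj G v u)

minDeg maxDeg : Graph → ℕ
minDeg G = minF (deg G)
maxDeg G = maxF (deg G)

card : (G : Graph) → VSet G → ℕ
card G S = count S

δ : (G : Graph) → VSet G → Fin (n G) → ℕ
δ G S v = count (λ u → S u ∧ adj G u v)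

complement : (G : Graph) → VSet G → VSet G
complement G S v = not (S v)

InBoundary : (G : Graph) → VSet G → Fin (n G) → Set
InBoundary G S v = (S v ≡ false) × (1 ℕ.≤ δ G S v)

IsOffensiveAlliance : (G : Graph) → ℤ → VSet G → Set
IsOffensiveAlliance G k S =
  (∃ λ v → S v ≡ true) ×
  (∀ v → InBoundary G S v → (+ δ G (complement G S) v) ℤ.+ k ℤ.≤ + δ G S v)

_⊆_ : {G : Graph} → VSet G → VSet G → Set
_⊆_ {G} S X = ∀ v → S v ≡ true → X v ≡ true

IsOAF : (G : Graph) → ℤ → VSet G → Set
IsOAF G k X = ∀ (S : VSet G) → _⊆_ {G} S X → ¬ IsOffensiveAlliance G k S

IsPhi : (G : Graph) → ℤ → ℕ → Set
IsPhi G k m = (Σ (VSet G) λ X → IsOAF G k X × card G X ≡ m)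
            × (∀ X → IsOAF G k X → card G X ℕ.≤ m)

-- Cartesian product; vertex x of Fin (n1 * n2) corresponds to remQuot n2 x = (a , b)
_□_ : Graph → Graph → Graph
G₁ □ G₂ = record
  { n   = n G₁ ℕ.* n G₂
  ; adj = λ x y → prodAdj (remQuot (n G₂) x) (remQuot (n G₂) y)
  }
  where
  prodAdj : Fin (n G₁) × Fin (n G₂) → Fin (n G₁) × Fin (n G₂) → Bool
  prodAdj (a , b) (c , d) = (⌊ a ≟ c ⌋ ∧ adj G₂ b d) ∨ (⌊ b ≟ d ⌋ ∧ adj G₁ a c)

module Submission where

open import Defs
open import Data.Nat using (ℕ)
open import Data.Integer using (ℤ; +_; _+_; _-_; _*_; _≤_; _⊔_; _⊓_)
open import Data.Product using (_×_)

-- Let X₁ be a k₁-oaf set of G₁ and X₂ a k₂-oaf set of G₂, both of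
-- maximum size.  We show that the "cross" X = (X₁ × V₂) ∪ (V₁ × X₂) is k-oaf in
-- G₁ □ G₂; since |X| = n₁p₂ + n₂p₁ - p₁p₂ this gives the bound.
--
-- Let S ⊆ X be an offensive k-alliance.  The neighbours of (a,b) in the product
-- split into its row {a} × V₂ and its column V₁ × {b}, so the alliance condition
-- can be read in coordinates.  Suppose k ≥ k₂ + Δ₁ (the other case of the min is
-- symmetric).  If S meets some row {a} × V₂ with a ∉ X₁, that row fibre lies in X₂
-- and is an offensive k₂-alliance of G₂ (the column part of a degree is at most
-- Δ₁).  Otherwise S ⊆ X₁ × V₂ and its projection onto V₁ lies in X₁ and is an
-- offensive k₁-alliance of G₁ (here k ≥ k₁ - δ₂ is used).  Both contradict
-- the choice of X₁, X₂.

import Data.Nat as ℕ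
import Data.Nat.Properties as ℕP
import Data.Integer.Properties as ℤP
open import Data.Nat using (zero; suc; z≤n; s≤s)
open import Data.Integer using (0ℤ; +≤+)
open import Data.Integer.Tactic.RingSolver using (solve-∀)
open import Data.Bool using (Bool; true; false; _∧_; _∨_; not) renaming (_≟_ to _≟ᵇ_)
open import Data.Bool.Properties using (∧-distribˡ-∨; ∧-zeroʳ; ∧-conicalˡ; ∧-conicalʳ; ∨-comm; ∨-identityʳ; ¬-not)
open import Data.Fin using (Fin; zero; suc; combine; remQuot; _↑ˡ_; _↑ʳ_; punchIn; _≟_)
open import Data.Fin.Properties using (remQuot-combine; combine-remQuot; punchInᵢ≢i; any?)
open import Data.Product using (_,_; proj₁; proj₂; ∃)
open import Data.Sum using ([_,_]′)
open import Data.Empty using (⊥)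
open import Function using (_∘_; flip)
open import Relation.Nullary using (¬_; Dec; yes; no)
open import Relation.Nullary.Decidable using (⌊_⌋; isYes≗does; dec-true; dec-false; _×-dec_)
open import Relation.Binary.PropositionalEquality
open import Algebra.Properties.CommutativeMonoid.Sum ℕP.+-0-commutativeMonoid
  using (sum; sum-cong-≗; ∑-distrib-+; sum-remove)
open import Algebra.Properties.Semiring.Sum ℕP.+-*-semiring using (*-distribʳ-sum)

open ≡-Reasoning

⌊⌋-yes : ∀ {P : Set} (d : Dec P) → P → ⌊ d ⌋ ≡ true
⌊⌋-yes d p = trans (isYes≗does d) (dec-true d p)

⌊⌋-no : ∀ {P : Set} (d : Dec P) → ¬ P → ⌊ d ⌋ ≡ false
⌊⌋-no d ¬p = trans (isYes≗does d) (dec-false d ¬p)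

⌊⌋-yes⁻ : ∀ {P : Set} (d : Dec P) → ⌊ d ⌋ ≡ true → P
⌊⌋-yes⁻ (yes p) _ = p

⌊⌋-no⁻ : ∀ {P : Set} (d : Dec P) → ⌊ d ⌋ ≡ false → ¬ P
⌊⌋-no⁻ (no ¬p) _ = ¬p

-- count is the sum of the 0/1 indicators, so the summation library applies
count≡sum : ∀ {m} (p : Fin m → Bool) → count p ≡ sum (b2n ∘ p)
count≡sum {zero}  p = refl
count≡sum {suc m} p = cong (b2n (p zero) ℕ.+_) (count≡sum (p ∘ suc))

count-cong : ∀ {m} {p q : Fin m → Bool} → (∀ i → p i ≡ q i) → count p ≡ count q
count-cong {zero}  eq = refl
count-cong {suc m} eq = cong₂ ℕ._+_ (cong b2n (eq zero)) (count-cong (eq ∘ suc))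

count-true : ∀ m → count {m} (λ _ → true) ≡ m
count-true zero    = refl
count-true (suc m) = cong suc (count-true m)

count-none : ∀ {m} {p : Fin m → Bool} → (∀ i → p i ≡ false) → count p ≡ 0
count-none {zero}  none = refl
count-none {suc m} none = cong₂ ℕ._+_ (cong b2n (none zero)) (count-none (none ∘ suc))

count-witness : ∀ {m} {p : Fin m → Bool} (i : Fin m) → p i ≡ true → 1 ℕ.≤ count p
count-witness zero    pi rewrite pi = s≤s z≤n
count-witness {p = p} (suc i) pi =
  ℕP.≤-trans (count-witness {p = p ∘ suc} i pi) (ℕP.m≤n+m _ (b2n (p zero)))

count-witness⁻ : ∀ {m} (p : Fin m → Bool) → 1 ℕ.≤ count p → ∃ λ i → p i ≡ true
count-witness⁻ {suc m} p pos with p zero in p0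
... | true  = zero , p0
... | false = let (i , pi) = count-witness⁻ (p ∘ suc) pos in suc i , pi

count-mono : ∀ {m} (p q : Fin m → Bool) → (∀ i → p i ≡ true → q i ≡ true) →
  count p ℕ.≤ count q
count-mono {zero}  p q p⊆q = z≤n
count-mono {suc m} p q p⊆q with p zero in p0
... | false = ℕP.≤-trans (count-mono (p ∘ suc) (q ∘ suc) (p⊆q ∘ suc)) (ℕP.m≤n+m _ (b2n (q zero)))
... | true rewrite p⊆q zero p0 = s≤s (count-mono (p ∘ suc) (q ∘ suc) (p⊆q ∘ suc))

count-∨ : ∀ {m} (p q : Fin m → Bool) → (∀ i → p i ∧ q i ≡ false) →
  count (λ i → p i ∨ q i) ≡ count p ℕ.+ count q
count-∨ p q disjoint = begin
  count (λ i → p i ∨ q i)                    ≡⟨ count≡sum (λ i → p i ∨ q i) ⟩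
  sum (λ i → b2n (p i ∨ q i))                ≡⟨ sum-cong-≗ (λ i → b2n-∨ (p i) (q i) (disjoint i)) ⟩
  sum (λ i → b2n (p i) ℕ.+ b2n (q i))        ≡⟨ ∑-distrib-+ (b2n ∘ p) (b2n ∘ q) ⟩
  sum (b2n ∘ p) ℕ.+ sum (b2n ∘ q)            ≡⟨ cong₂ ℕ._+_ (count≡sum p) (count≡sum q) ⟨
  count p ℕ.+ count q                        ∎
  where
  b2n-∨ : ∀ x y → x ∧ y ≡ false → b2n (x ∨ y) ≡ b2n x ℕ.+ b2n y
  b2n-∨ true  false _ = refl
  b2n-∨ false y     _ = refl

count-partition : ∀ {m} (p q : Fin m → Bool) →
  count (λ i → p i ∧ q i) ℕ.+ count (λ i → not (p i) ∧ q i) ≡ count q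
count-partition p q =
  trans (sym (count-∨ _ _ (λ i → disjoint (p i) (q i)))) (count-cong (λ i → rejoin (p i) (q i)))
  where
  disjoint : ∀ x y → (x ∧ y) ∧ (not x ∧ y) ≡ false
  disjoint true  y = ∧-zeroʳ y
  disjoint false y = refl
  rejoin : ∀ x y → (x ∧ y) ∨ (not x ∧ y) ≡ y
  rejoin true  y = ∨-identityʳ y
  rejoin false y = refl

sum-const : ∀ m c → sum {m} (λ _ → c) ≡ m ℕ.* c
sum-const zero    c = refl
sum-const (suc m) c = cong (c ℕ.+_) (sum-const m c)

sum-single : ∀ {m} (f : Fin m → ℕ) (a : Fin m) → (∀ i → i ≢ a → f i ≡ 0) → sum f ≡ f a
sum-single {suc m} f a others = begin
  sum f                                     ≡⟨ sum-remove {i = a} f ⟩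
  f a ℕ.+ sum (f ∘ punchIn a)               ≡⟨ cong (f a ℕ.+_) (sum-cong-≗ (λ j → others _ (punchInᵢ≢i a j))) ⟩
  f a ℕ.+ sum {m} (λ _ → 0)                 ≡⟨ cong (f a ℕ.+_) (trans (sum-const m 0) (ℕP.*-zeroʳ m)) ⟩
  f a ℕ.+ 0                                 ≡⟨ ℕP.+-identityʳ (f a) ⟩
  f a                                       ∎

count-single : ∀ {m} (p : Fin m → Bool) (a : Fin m) → (∀ i → i ≢ a → p i ≡ false) →
  count p ≡ b2n (p a)
count-single p a others = trans (count≡sum p) (sum-single _ a (λ i i≢a → cong b2n (others i i≢a)))

-- Fin (m * n) enumerates the pairs combine a b, block by block
count-product : ∀ {m n} (f : Fin (m ℕ.* n) → Bool) →
  count f ≡ sum {m} (λ a → count (λ b → f (combine a b)))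
count-product {zero}      f = refl
count-product {suc m} {n} f =
  trans (count-++ {n} {m ℕ.* n} f)
        (cong (count (λ b → f (b ↑ˡ m ℕ.* n)) ℕ.+_) (count-product {m} {n} (f ∘ (n ↑ʳ_))))
  where
  count-++ : ∀ {p q} (g : Fin (p ℕ.+ q) → Bool) →
    count g ≡ count (λ i → g (i ↑ˡ q)) ℕ.+ count (λ j → g (p ↑ʳ j))
  count-++ {zero}  g = refl
  count-++ {suc p} {q} g =
    trans (cong (b2n (g zero) ℕ.+_) (count-++ {p} {q} (g ∘ suc))) (sym (ℕP.+-assoc (b2n (g zero)) _ _))

Symmetric Loopless : Graph → Set
Symmetric G = ∀ u v → adj G u v ≡ adj G v u
Loopless  G = ∀ v → adj G v v ≡ false

everything : (G : Graph) → VSet G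
everything G _ = true

δ-partition : (G : Graph) (S : VSet G) (v : Fin (n G)) →
  δ G S v ℕ.+ δ G (complement G S) v ≡ δ G (everything G) v
δ-partition G S v = count-partition S (λ u → adj G u v)

δ-everything : (G : Graph) → Symmetric G → ∀ v → δ G (everything G) v ≡ deg G v
δ-everything G sym v = count-cong (λ u → sym u v)

δ-mono : (G : Graph) (S S′ : VSet G) → _⊆_ {G} S S′ → ∀ v → δ G S v ℕ.≤ δ G S′ v
δ-mono G S S′ S⊆S′ v = count-mono _ _ (λ u → enlarge (S⊆S′ u))
  where
  enlarge : ∀ {x y z} → (x ≡ true → y ≡ true) → x ∧ z ≡ true → y ∧ z ≡ true
  enlarge {true} x⇒y x∧z rewrite x⇒y refl = x∧z

deg≤maxDeg : (G : Graph) (v : Fin (n G)) → deg G v ℕ.≤ maxDeg G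
deg≤maxDeg G = maxF-ub (deg G)
  where
  maxF-ub : ∀ {m} (f : Fin m → ℕ) i → f i ℕ.≤ maxF f
  maxF-ub f zero    = ℕP.m≤m⊔n _ _
  maxF-ub f (suc i) = ℕP.≤-trans (maxF-ub (f ∘ suc) i) (ℕP.m≤n⊔m _ _)

minDeg≤deg : (G : Graph) (v : Fin (n G)) → minDeg G ℕ.≤ deg G v
minDeg≤deg G = minF-lb (deg G)
  where
  minF-lb : ∀ {m} (f : Fin m → ℕ) i → minF f ℕ.≤ f i
  minF-lb {suc zero}    f zero    = ℕP.≤-refl
  minF-lb {suc (suc m)} f zero    = ℕP.m⊓n≤m _ _
  minF-lb {suc (suc m)} f (suc i) = ℕP.≤-trans (ℕP.m⊓n≤n _ _) (minF-lb (f ∘ suc) i)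

□-adj : (G₁ G₂ : Graph) (a′ a : Fin (n G₁)) (b′ b : Fin (n G₂)) →
  adj (G₁ □ G₂) (combine a′ b′) (combine a b)
    ≡ (⌊ a′ ≟ a ⌋ ∧ adj G₂ b′ b) ∨ (⌊ b′ ≟ b ⌋ ∧ adj G₁ a′ a)
□-adj G₁ G₂ a′ a b′ b =
  cong₂ pairAdj (remQuot-combine {n G₁} {n G₂} a′ b′) (remQuot-combine {n G₁} {n G₂} a b)
  where
  pairAdj : Fin (n G₁) × Fin (n G₂) → Fin (n G₁) × Fin (n G₂) → Bool
  pairAdj (a′ , b′) (a , b) = (⌊ a′ ≟ a ⌋ ∧ adj G₂ b′ b) ∨ (⌊ b′ ≟ b ⌋ ∧ adj G₁ a′ a)

sum-row-count : ∀ {m n} (P : Fin m → Fin n → Bool) (r : Fin n → Bool) (a : Fin m) →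
  sum (λ a′ → count (λ b′ → P a′ b′ ∧ (⌊ a′ ≟ a ⌋ ∧ r b′))) ≡ count (λ b′ → P a b′ ∧ r b′)
sum-row-count P r a =
  trans (sum-single _ a otherRow)
        (count-cong (λ b′ → cong (λ t → P a b′ ∧ (t ∧ r b′)) (⌊⌋-yes (a ≟ a) refl)))
  where
  otherRow : ∀ a′ → a′ ≢ a → count (λ b′ → P a′ b′ ∧ (⌊ a′ ≟ a ⌋ ∧ r b′)) ≡ 0
  otherRow a′ a′≢a = count-none (λ b′ →
    trans (cong (λ t → P a′ b′ ∧ (t ∧ r b′)) (⌊⌋-no (a′ ≟ a) a′≢a)) (∧-zeroʳ (P a′ b′)))

sum-column-count : ∀ {m n} (P : Fin m → Fin n → Bool) (r : Fin m → Bool) (b : Fin n) →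
  sum (λ a′ → count (λ b′ → P a′ b′ ∧ (⌊ b′ ≟ b ⌋ ∧ r a′))) ≡ count (λ a′ → P a′ b ∧ r a′)
sum-column-count {m} P r b = begin
  sum (λ a′ → count (λ b′ → P a′ b′ ∧ (⌊ b′ ≟ b ⌋ ∧ r a′)))
    ≡⟨ sum-cong-≗ (λ a′ → count-single _ b (otherColumn a′)) ⟩
  sum (λ a′ → b2n (P a′ b ∧ (⌊ b ≟ b ⌋ ∧ r a′)))
    ≡⟨ sum-cong-≗ (λ a′ → cong (λ t → b2n (P a′ b ∧ (t ∧ r a′))) (⌊⌋-yes (b ≟ b) refl)) ⟩
  sum (λ a′ → b2n (P a′ b ∧ r a′))
    ≡⟨ count≡sum {m} (λ a′ → P a′ b ∧ r a′) ⟨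
  count (λ a′ → P a′ b ∧ r a′)
    ∎
  where
  otherColumn : ∀ a′ b′ → b′ ≢ b → P a′ b′ ∧ (⌊ b′ ≟ b ⌋ ∧ r a′) ≡ false
  otherColumn a′ b′ b′≢b =
    trans (cong (λ t → P a′ b′ ∧ (t ∧ r a′)) (⌊⌋-no (b′ ≟ b) b′≢b)) (∧-zeroʳ (P a′ b′))

□-row∧column : (G₁ G₂ : Graph) → Loopless G₂ → (a′ a : Fin (n G₁)) (b′ b : Fin (n G₂)) →
  (⌊ a′ ≟ a ⌋ ∧ adj G₂ b′ b) ∧ (⌊ b′ ≟ b ⌋ ∧ adj G₁ a′ a) ≡ false
□-row∧column G₁ G₂ loopless a′ a b′ b with b′ ≟ b
... | yes refl rewrite loopless b = cong (_∧ adj G₁ a′ a) (∧-zeroʳ ⌊ a′ ≟ a ⌋)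
... | no _     = ∧-zeroʳ _

δ-□ : (G₁ G₂ : Graph) → Loopless G₂ → (Q : VSet (G₁ □ G₂)) (a : Fin (n G₁)) (b : Fin (n G₂)) →
  δ (G₁ □ G₂) Q (combine a b)
    ≡ δ G₂ (λ b′ → Q (combine a b′)) b ℕ.+ δ G₁ (λ a′ → Q (combine a′ b)) a
δ-□ G₁ G₂ loopless Q a b = begin
  δ (G₁ □ G₂) Q (combine a b)
    ≡⟨ count-product {n G₁} {n G₂} (λ x → Q x ∧ adj (G₁ □ G₂) x (combine a b)) ⟩
  sum {n G₁} (λ a′ → count (λ b′ → Q (combine a′ b′) ∧ adj (G₁ □ G₂) (combine a′ b′) (combine a b)))
    ≡⟨ sum-cong-≗ {n G₁} split ⟩
  sum {n G₁} (λ a′ → count (inRow a′) ℕ.+ count (inColumn a′))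
    ≡⟨ ∑-distrib-+ (count ∘ inRow) (count ∘ inColumn) ⟩
  sum {n G₁} (count ∘ inRow) ℕ.+ sum {n G₁} (count ∘ inColumn)
    ≡⟨ cong₂ ℕ._+_ (sum-row-count P (λ b′ → adj G₂ b′ b) a) (sum-column-count P (λ a′ → adj G₁ a′ a) b) ⟩
  δ G₂ (λ b′ → Q (combine a b′)) b ℕ.+ δ G₁ (λ a′ → Q (combine a′ b)) a
    ∎
  where
  P : Fin (n G₁) → Fin (n G₂) → Bool
  P a′ b′ = Q (combine a′ b′)

  inRow inColumn : Fin (n G₁) → Fin (n G₂) → Bool
  inRow    a′ b′ = Q (combine a′ b′) ∧ (⌊ a′ ≟ a ⌋ ∧ adj G₂ b′ b)
  inColumn a′ b′ = Q (combine a′ b′) ∧ (⌊ b′ ≟ b ⌋ ∧ adj G₁ a′ a)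

  disjoint : ∀ q x y → x ∧ y ≡ false → (q ∧ x) ∧ (q ∧ y) ≡ false
  disjoint true  x y x∧y = x∧y
  disjoint false x y _   = refl

  split : ∀ a′ → count (λ b′ → Q (combine a′ b′) ∧ adj (G₁ □ G₂) (combine a′ b′) (combine a b))
                   ≡ count (inRow a′) ℕ.+ count (inColumn a′)
  split a′ = trans
    (count-cong (λ b′ → trans (cong (Q (combine a′ b′) ∧_) (□-adj G₁ G₂ a′ a b′ b))
                              (∧-distribˡ-∨ (Q (combine a′ b′)) _ _)))
    (count-∨ (inRow a′) (inColumn a′) (λ b′ → disjoint (Q (combine a′ b′)) _ _ (□-row∧column G₁ G₂ loopless a′ a b′ b)))

-- the column fibre {a : (a , b) ∈ T} of a set T ⊆ V₁ × V₂; the row fibre is T a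
column : ∀ {m n} → (Fin m → Fin n → Bool) → Fin n → Fin m → Bool
column T b a = T a b

-- The offensive k-alliance condition in G₁ □ G₂ for T ⊆ V₁ × V₂, with the
-- neighbourhood of (a , b) split into its row part and its column part.
OffensiveInProduct : (G₁ G₂ : Graph) → ℤ → (Fin (n G₁) → Fin (n G₂) → Bool) → Set
OffensiveInProduct G₁ G₂ k T = ∀ a b → T a b ≡ false →
  1 ℕ.≤ δ G₂ (T a) b ℕ.+ δ G₁ (column T b) a →
  + δ G₂ (complement G₂ (T a)) b + + δ G₁ (complement G₁ (column T b)) a + k
    ≤ + δ G₂ (T a) b + + δ G₁ (column T b) a

alliance⇒offensiveInProduct : (G₁ G₂ : Graph) → Loopless G₂ → (k : ℤ) (S : VSet (G₁ □ G₂)) →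
  IsOffensiveAlliance (G₁ □ G₂) k S → OffensiveInProduct G₁ G₂ k (λ a b → S (combine a b))
alliance⇒offensiveInProduct G₁ G₂ loopless k S (_ , offensive) a b ab∉S hasNeighbour =
  subst₂ (λ out inn → out + k ≤ inn) (split (complement (G₁ □ G₂) S)) (split S)
    (offensive (combine a b) (ab∉S , subst (1 ℕ.≤_) (sym (δ-□ G₁ G₂ loopless S a b)) hasNeighbour))
  where
  split : ∀ Q → + δ (G₁ □ G₂) Q (combine a b)
                ≡ + δ G₂ (λ b′ → Q (combine a b′)) b + + δ G₁ (λ a′ → Q (combine a′ b)) a
  split Q = trans (cong +_ (δ-□ G₁ G₂ loopless Q a b))
                  (ℤP.pos-+ (δ G₂ (λ b′ → Q (combine a b′)) b) (δ G₁ (λ a′ → Q (combine a′ b)) a))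

offensiveInProduct-swap : (G₁ G₂ : Graph) (k : ℤ) (T : Fin (n G₁) → Fin (n G₂) → Bool) →
  OffensiveInProduct G₁ G₂ k T → OffensiveInProduct G₂ G₁ k (flip T)
offensiveInProduct-swap G₁ G₂ k T offensive b a ab∉T hasNeighbour =
  subst₂ (λ out inn → out + k ≤ inn)
    (ℤP.+-comm (+ δ G₂ (complement G₂ (T a)) b) (+ δ G₁ (complement G₁ (column T b)) a))
    (ℤP.+-comm (+ δ G₂ (T a) b) (+ δ G₁ (column T b) a))
    (offensive a b ab∉T (subst (1 ℕ.≤_) (ℕP.+-comm _ (δ G₂ (T a) b)) hasNeighbour))

slack : ∀ {x y} (d : ℤ) → 0ℤ ≤ d → y - x ≡ d → x ≤ y
slack d 0≤d y-x≡d = ℤP.0≤i-j⇒j≤i (subst (0ℤ ≤_) (sym y-x≡d) 0≤d)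

infixl 6 _⊕_
_⊕_ : ∀ {x y} → 0ℤ ≤ x → 0ℤ ≤ y → 0ℤ ≤ x + y
_⊕_ = ℤP.+-mono-≤

gap : ∀ {x y} → x ≤ y → 0ℤ ≤ y - x
gap = ℤP.i≤j⇒0≤j-i

-- Row fibre: in₂/out₂ count neighbours in the row inside/outside the alliance,
-- in₁/out₁ those in the column, and the column has at most Δ neighbours.
fibre-bound : ∀ (in₂ out₂ in₁ out₁ Δ k k₂ : ℤ) →
  out₂ + out₁ + k ≤ in₂ + in₁ → in₁ + out₁ ≤ Δ → k₂ + Δ ≤ k → 0ℤ ≤ out₁ →
  out₂ + k₂ ≤ in₂
fibre-bound in₂ out₂ in₁ out₁ Δ k k₂ h₁ h₂ h₃ h₄ =
  slack _ (gap h₁ ⊕ gap h₂ ⊕ gap h₃ ⊕ gap h₄ ⊕ gap h₄) (slacks in₂ out₂ in₁ out₁ Δ k k₂)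
  where
  slacks : ∀ in₂ out₂ in₁ out₁ Δ k k₂ →
    in₂ - (out₂ + k₂) ≡ (in₂ + in₁ - (out₂ + out₁ + k)) + (Δ - (in₁ + out₁)) + (k - (k₂ + Δ))
                        + (out₁ - 0ℤ) + (out₁ - 0ℤ)
  slacks = solve-∀

-- Projection: the row part is empty (in₂ = 0, out₂ ≥ δ₂), the column part has the
-- same total s + c as the neighbourhood in G₁ and in₁ ≤ s.
shadow-bound : ∀ (in₂ out₂ in₁ out₁ s c δ₂ k k₁ : ℤ) →
  out₂ + out₁ + k ≤ in₂ + in₁ → in₂ ≤ 0ℤ → δ₂ ≤ out₂ → s + c ≤ in₁ + out₁ → in₁ ≤ s →
  k₁ - δ₂ ≤ k → c + k₁ ≤ s
shadow-bound in₂ out₂ in₁ out₁ s c δ₂ k k₁ h₁ h₂ h₃ h₄ h₅ h₆ =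
  slack _ (gap h₁ ⊕ gap h₂ ⊕ gap h₃ ⊕ gap h₄ ⊕ gap h₅ ⊕ gap h₅ ⊕ gap h₆)
    (slacks in₂ out₂ in₁ out₁ s c δ₂ k k₁)
  where
  slacks : ∀ in₂ out₂ in₁ out₁ s c δ₂ k k₁ →
    s - (c + k₁) ≡ (in₂ + in₁ - (out₂ + out₁ + k)) + (0ℤ - in₂) + (out₂ - δ₂)
                   + (in₁ + out₁ - (s + c)) + (s - in₁) + (s - in₁) + (k - (k₁ - δ₂))
  slacks = solve-∀

-- If k ≥ k₂ + Δ₁, every non-empty row fibre of an offensive k-alliance of the
-- product is an offensive k₂-alliance of G₂: the column part of a degree is ≤ Δ₁.
row-fibre-alliance : (G₁ G₂ : Graph) → Symmetric G₁ → (k k₂ : ℤ) → k₂ + + maxDeg G₁ ≤ k →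
  (T : Fin (n G₁) → Fin (n G₂) → Bool) → OffensiveInProduct G₁ G₂ k T →
  ∀ a b → T a b ≡ true → IsOffensiveAlliance G₂ k₂ (T a)
row-fibre-alliance G₁ G₂ sym₁ k k₂ k≥ T offensive a b ab∈T = (b , ab∈T) , boundary
  where
  boundary : ∀ b′ → InBoundary G₂ (T a) b′ →
    + δ G₂ (complement G₂ (T a)) b′ + k₂ ≤ + δ G₂ (T a) b′
  boundary b′ (ab′∉T , hasNeighbour) =
    fibre-bound (+ δ G₂ (T a) b′) (+ δ G₂ (complement G₂ (T a)) b′)
                (+ δ G₁ (column T b′) a) (+ δ G₁ (complement G₁ (column T b′)) a) (+ maxDeg G₁) k k₂
      (offensive a b′ ab′∉T (ℕP.≤-trans hasNeighbour (ℕP.m≤m+n _ _)))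
      (+≤+ columnDegree) k≥ (+≤+ z≤n)
    where
    columnDegree : δ G₁ (column T b′) a ℕ.+ δ G₁ (complement G₁ (column T b′)) a ℕ.≤ maxDeg G₁
    columnDegree = subst (ℕ._≤ maxDeg G₁)
      (sym (trans (δ-partition G₁ (column T b′) a) (δ-everything G₁ sym₁ a))) (deg≤maxDeg G₁ a)

shadow : ∀ {m n} → (Fin m → Fin n → Bool) → Fin m → Bool
shadow T a = ⌊ any? (λ b → T a b ≟ᵇ true) ⌋

shadow-intro : ∀ {m n} (T : Fin m → Fin n → Bool) a b → T a b ≡ true → shadow T a ≡ true
shadow-intro T a b ab∈T = ⌊⌋-yes (any? (λ b → T a b ≟ᵇ true)) (b , ab∈T)

shadow-elim : ∀ {m n} (T : Fin m → Fin n → Bool) a → shadow T a ≡ true → ∃ λ b → T a b ≡ true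
shadow-elim T a = ⌊⌋-yes⁻ (any? (λ b → T a b ≟ᵇ true))

shadow-empty : ∀ {m n} (T : Fin m → Fin n → Bool) a → shadow T a ≡ false → ∀ b → T a b ≡ false
shadow-empty T a a∉ b = ¬-not (λ ab∈T → ⌊⌋-no⁻ (any? (λ b → T a b ≟ᵇ true)) a∉ (b , ab∈T))

-- If k ≥ k₁ - δ₂, the projection onto V₁ of an offensive k-alliance of the product
-- is an offensive k₁-alliance of G₁: a boundary vertex a₀ of the projection has an
-- empty row, so above it sits a boundary vertex (a₀ , b₀) whose row part is all
-- outside the alliance and has at least δ₂ vertices.
shadow-alliance : (G₁ G₂ : Graph) → Symmetric G₂ → (k k₁ : ℤ) → k₁ - + minDeg G₂ ≤ k →
  (T : Fin (n G₁) → Fin (n G₂) → Bool) → OffensiveInProduct G₁ G₂ k T →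
  ∀ a b → T a b ≡ true → IsOffensiveAlliance G₁ k₁ (shadow T)
shadow-alliance G₁ G₂ sym₂ k k₁ k≥ T offensive a b ab∈T = (a , shadow-intro T a b ab∈T) , boundary
  where
  boundary : ∀ a₀ → InBoundary G₁ (shadow T) a₀ →
    + δ G₁ (complement G₁ (shadow T)) a₀ + k₁ ≤ + δ G₁ (shadow T) a₀
  boundary a₀ (a₀∉ , hasNeighbour) =
    shadow-bound (+ δ G₂ (T a₀) b₀) (+ δ G₂ (complement G₂ (T a₀)) b₀)
                 (+ δ G₁ (column T b₀) a₀) (+ δ G₁ (complement G₁ (column T b₀)) a₀)
                 (+ δ G₁ (shadow T) a₀) (+ δ G₁ (complement G₁ (shadow T)) a₀) (+ minDeg G₂) k k₁
      (offensive a₀ b₀ (rowEmpty b₀) reachesColumn)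
      (+≤+ (ℕP.≤-reflexive rowInside))
      (+≤+ (subst (minDeg G₂ ℕ.≤_) (sym rowOutside) (minDeg≤deg G₂ b₀)))
      (+≤+ (ℕP.≤-reflexive sameNeighbourhood))
      (+≤+ (δ-mono G₁ (column T b₀) (shadow T) (λ a′ → shadow-intro T a′ b₀) a₀))
      k≥
    where
    rowEmpty : ∀ b′ → T a₀ b′ ≡ false
    rowEmpty = shadow-empty T a₀ a₀∉

    neighbour : ∃ λ a₁ → shadow T a₁ ∧ adj G₁ a₁ a₀ ≡ true
    neighbour = count-witness⁻ (λ a′ → shadow T a′ ∧ adj G₁ a′ a₀) hasNeighbour
    a₁ : Fin (n G₁)
    a₁ = proj₁ neighbour
    above : ∃ λ b₀ → T a₁ b₀ ≡ true
    above = shadow-elim T a₁ (∧-conicalˡ _ _ (proj₂ neighbour))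
    b₀ : Fin (n G₂)
    b₀ = proj₁ above

    reachesColumn : 1 ℕ.≤ δ G₂ (T a₀) b₀ ℕ.+ δ G₁ (column T b₀) a₀
    reachesColumn = ℕP.≤-trans
      (count-witness a₁ (subst (λ x → x ∧ adj G₁ a₁ a₀ ≡ true) (sym (proj₂ above))
                               (∧-conicalʳ _ _ (proj₂ neighbour))))
      (ℕP.m≤n+m _ _)

    rowInside : δ G₂ (T a₀) b₀ ≡ 0
    rowInside = count-none (λ b′ → cong (_∧ adj G₂ b′ b₀) (rowEmpty b′))

    rowOutside : δ G₂ (complement G₂ (T a₀)) b₀ ≡ deg G₂ b₀
    rowOutside = trans (cong (ℕ._+ δ G₂ (complement G₂ (T a₀)) b₀) (sym rowInside))
                       (trans (δ-partition G₂ (T a₀) b₀) (δ-everything G₂ sym₂ b₀))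

    sameNeighbourhood : δ G₁ (shadow T) a₀ ℕ.+ δ G₁ (complement G₁ (shadow T)) a₀
                        ≡ δ G₁ (column T b₀) a₀ ℕ.+ δ G₁ (complement G₁ (column T b₀)) a₀
    sameNeighbourhood = trans (δ-partition G₁ (shadow T) a₀) (sym (δ-partition G₁ (column T b₀) a₀))

cross : ∀ {m n} → (Fin m → Bool) → (Fin n → Bool) → Fin (m ℕ.* n) → Bool
cross {m} {n} P Q x = P (proj₁ (remQuot {m} n x)) ∨ Q (proj₂ (remQuot {m} n x))

cross-combine : ∀ {m n} (P : Fin m → Bool) (Q : Fin n → Bool) a b →
  cross P Q (combine a b) ≡ P a ∨ Q b
cross-combine {m} {n} P Q a b = cong (λ ab → P (proj₁ ab) ∨ Q (proj₂ ab)) (remQuot-combine {m} {n} a b)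

count-cross : ∀ {m n} (P : Fin m → Bool) (Q : Fin n → Bool) →
  count (cross P Q) ℕ.+ count P ℕ.* count Q ≡ count P ℕ.* n ℕ.+ m ℕ.* count Q
count-cross {m} {n} P Q = begin
  count (cross P Q) ℕ.+ count P ℕ.* count Q
    ≡⟨ cong₂ ℕ._+_ rows (cong (ℕ._* count Q) (count≡sum P)) ⟩
  sum (count ∘ row) ℕ.+ sum (b2n ∘ P) ℕ.* count Q
    ≡⟨ cong (sum (count ∘ row) ℕ.+_) (*-distribʳ-sum (count Q) (b2n ∘ P)) ⟩
  sum (count ∘ row) ℕ.+ sum (λ a → b2n (P a) ℕ.* count Q)
    ≡⟨ ∑-distrib-+ (count ∘ row) (λ a → b2n (P a) ℕ.* count Q) ⟨
  sum (λ a → count (row a) ℕ.+ b2n (P a) ℕ.* count Q)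
    ≡⟨ sum-cong-≗ (λ a → row-size (P a)) ⟩
  sum (λ a → b2n (P a) ℕ.* n ℕ.+ count Q)
    ≡⟨ ∑-distrib-+ (λ a → b2n (P a) ℕ.* n) (λ _ → count Q) ⟩
  sum (λ a → b2n (P a) ℕ.* n) ℕ.+ sum {m} (λ _ → count Q)
    ≡⟨ cong₂ ℕ._+_ (sym (*-distribʳ-sum n (b2n ∘ P))) (sum-const m (count Q)) ⟩
  sum (b2n ∘ P) ℕ.* n ℕ.+ m ℕ.* count Q
    ≡⟨ cong (λ t → t ℕ.* n ℕ.+ m ℕ.* count Q) (count≡sum P) ⟨
  count P ℕ.* n ℕ.+ m ℕ.* count Q
    ∎
  where
  row : Fin m → Fin n → Bool
  row a b = P a ∨ Q b

  rows : count (cross P Q) ≡ sum (count ∘ row)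
  rows = trans (count-product {m} {n} (cross P Q))
               (sum-cong-≗ (λ a → count-cong (cross-combine {m} {n} P Q a)))

  -- a full row if a ∈ P, a copy of Q otherwise
  row-size : ∀ x → count (λ b → x ∨ Q b) ℕ.+ b2n x ℕ.* count Q ≡ b2n x ℕ.* n ℕ.+ count Q
  row-size true  = cong₂ ℕ._+_ (trans (count-true n) (sym (ℕP.*-identityˡ n))) (ℕP.*-identityˡ (count Q))
  row-size false = ℕP.+-identityʳ (count Q)

-- An offensive k-alliance T of the product inside the cross of X₁ and X₂ is
-- impossible when k ≥ k₂ + Δ₁ and k ≥ k₁ - δ₂: either it meets a row {a} × V₂
-- with a ∉ X₁, whose fibre is an alliance inside X₂, or its projection is an
-- alliance inside X₁.
cross-escape : (G₁ G₂ : Graph) → Symmetric G₁ → Symmetric G₂ → (k k₁ k₂ : ℤ) →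
  k₂ + + maxDeg G₁ ≤ k → k₁ - + minDeg G₂ ≤ k →
  (X₁ : VSet G₁) (X₂ : VSet G₂) → IsOAF G₁ k₁ X₁ → IsOAF G₂ k₂ X₂ →
  (T : Fin (n G₁) → Fin (n G₂) → Bool) → OffensiveInProduct G₁ G₂ k T →
  ∀ a b → T a b ≡ true → (∀ a b → T a b ≡ true → X₁ a ∨ X₂ b ≡ true) → ⊥
cross-escape G₁ G₂ sym₁ sym₂ k k₁ k₂ k≥row k≥shadow X₁ X₂ free₁ free₂ T offensive a b ab∈T T⊆cross
  with any? (λ a′ → any? (λ b′ → (T a′ b′ ≟ᵇ true) ×-dec (X₁ a′ ≟ᵇ false)))
... | yes (a′ , b′ , a′b′∈T , a′∉X₁) =
  free₂ (T a′) rowInX₂ (row-fibre-alliance G₁ G₂ sym₁ k k₂ k≥row T offensive a′ b′ a′b′∈T)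
  where
  rowInX₂ : _⊆_ {G₂} (T a′) X₂
  rowInX₂ b″ a′b″∈T = subst (λ x → x ∨ X₂ b″ ≡ true) a′∉X₁ (T⊆cross a′ b″ a′b″∈T)
... | no noneOutside =
  free₁ (shadow T) shadowInX₁ (shadow-alliance G₁ G₂ sym₂ k k₁ k≥shadow T offensive a b ab∈T)
  where
  shadowInX₁ : _⊆_ {G₁} (shadow T) X₁
  shadowInX₁ a′ a′∈ = ¬-not (λ a′∉X₁ → noneOutside (a′ , proj₁ above , proj₂ above , a′∉X₁))
    where
    above : ∃ λ b′ → T a′ b′ ≡ true
    above = shadow-elim T a′ a′∈

-- the cross of a k₁-oaf set of G₁ and a k₂-oaf set of G₂ is k-oaf in G₁ □ G₂; the
-- minimum in the hypothesis selects whether cross-escape is applied as is or with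
-- the factors exchanged
cross-oaf : (G₁ G₂ : Graph) → IsSimple G₁ → IsSimple G₂ → (k₁ k₂ k : ℤ) →
  k₁ - + minDeg G₂ ≤ k → k₂ - + minDeg G₁ ≤ k → (k₂ + + maxDeg G₁) ⊓ (k₁ + + maxDeg G₂) ≤ k →
  (X₁ : VSet G₁) (X₂ : VSet G₂) → IsOAF G₁ k₁ X₁ → IsOAF G₂ k₂ X₂ →
  IsOAF (G₁ □ G₂) k (cross X₁ X₂)
cross-oaf G₁ G₂ (sym₁ , _) (sym₂ , loopless₂) k₁ k₂ k k≥₁ k≥₂ k≥min X₁ X₂ free₁ free₂
          S S⊆cross alliance@((v , v∈S) , _) =
  [ (λ min≡ → cross-escape G₁ G₂ sym₁ sym₂ k k₁ k₂ (subst (_≤ k) min≡ k≥min) k≥₁ X₁ X₂ free₁ free₂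
                 T offensive a₀ b₀ v∈T T⊆cross)
  , (λ min≡ → cross-escape G₂ G₁ sym₂ sym₁ k k₂ k₁ (subst (_≤ k) min≡ k≥min) k≥₂ X₂ X₁ free₂ free₁
                 (flip T) (offensiveInProduct-swap G₁ G₂ k T offensive) b₀ a₀ v∈T
                 (λ b a ab∈T → trans (∨-comm (X₂ b) (X₁ a)) (T⊆cross a b ab∈T)))
  ]′ (ℤP.⊓-sel (k₂ + + maxDeg G₁) (k₁ + + maxDeg G₂))
  where
  T : Fin (n G₁) → Fin (n G₂) → Bool
  T a b = S (combine a b)

  offensive : OffensiveInProduct G₁ G₂ k T
  offensive = alliance⇒offensiveInProduct G₁ G₂ loopless₂ k S alliance

  a₀ : Fin (n G₁)
  a₀ = proj₁ (remQuot {n G₁} (n G₂) v)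
  b₀ : Fin (n G₂)
  b₀ = proj₂ (remQuot {n G₁} (n G₂) v)

  v∈T : T a₀ b₀ ≡ true
  v∈T = trans (cong S (combine-remQuot {n G₁} (n G₂) v)) v∈S

  T⊆cross : ∀ a b → T a b ≡ true → X₁ a ∨ X₂ b ≡ true
  T⊆cross a b ab∈T = trans (sym (cross-combine X₁ X₂ a b)) (S⊆cross (combine a b) ab∈T)

integer-form : ∀ (c p₁ p₂ n₁ n₂ : ℕ) → c ℕ.+ p₁ ℕ.* p₂ ≡ p₁ ℕ.* n₂ ℕ.+ n₁ ℕ.* p₂ →
  + n₁ * + p₂ + + n₂ * + p₁ - + p₁ * + p₂ ≡ + c
integer-form c p₁ p₂ n₁ n₂ eq = begin
  + n₁ * + p₂ + + n₂ * + p₁ - + p₁ * + p₂     ≡⟨ regroup (+ n₁) (+ p₂) (+ n₂) (+ p₁) ⟩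
  (+ p₁ * + n₂ + + n₁ * + p₂) - + p₁ * + p₂   ≡⟨ cong (_- + p₁ * + p₂) lifted ⟨
  (+ c + + p₁ * + p₂) - + p₁ * + p₂           ≡⟨ cancel (+ c) (+ p₁ * + p₂) ⟩
  + c                                         ∎
  where
  regroup : ∀ a b c d → a * b + c * d - d * b ≡ (d * c + a * b) - d * b
  regroup = solve-∀
  cancel : ∀ x y → (x + y) - y ≡ x
  cancel = solve-∀
  lifted : + c + + p₁ * + p₂ ≡ + p₁ * + n₂ + + n₁ * + p₂
  lifted = begin
    + c + + p₁ * + p₂                   ≡⟨ cong (λ t → + c + t) (ℤP.pos-* p₁ p₂) ⟨
    + (c ℕ.+ p₁ ℕ.* p₂)                 ≡⟨ cong +_ eq ⟩
    + (p₁ ℕ.* n₂ ℕ.+ n₁ ℕ.* p₂)         ≡⟨ cong₂ _+_ (ℤP.pos-* p₁ n₂) (ℤP.pos-* n₁ p₂) ⟩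
    + p₁ * + n₂ + + n₁ * + p₂           ∎

-- Corollary 13.
corollary13 : (G₁ G₂ : Graph) → IsSimple G₁ → IsSimple G₂ →
    (k₁ k₂ : ℤ) →
    + 2 - + maxDeg G₁ ≤ k₁ → k₁ ≤ + maxDeg G₁ →
    + 2 - + maxDeg G₂ ≤ k₂ → k₂ ≤ + maxDeg G₂ →
    (k : ℤ) →
    ((k₁ - + minDeg G₂) ⊔ ((k₂ - + minDeg G₁) ⊔ ((k₂ + + maxDeg G₁) ⊓ (k₁ + + maxDeg G₂)))) ≤ k →
    k ≤ + maxDeg G₁ + + maxDeg G₂ →
    (p₁ p₂ m : ℕ) → IsPhi G₁ k₁ p₁ → IsPhi G₂ k₂ p₂ → IsPhi (G₁ □ G₂) k m →
    + n G₁ * + p₂ + + n G₂ * + p₁ - + p₁ * + p₂ ≤ + m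
corollary13 G₁ G₂ simple₁ simple₂ k₁ k₂ _ _ _ _ k k≥ _ p₁ p₂ m
            ((X₁ , free₁ , |X₁|≡p₁) , _) ((X₂ , free₂ , |X₂|≡p₂) , _) (_ , maximum) =
  subst (_≤ + m) (sym (integer-form (count (cross X₁ X₂)) p₁ p₂ (n G₁) (n G₂) crossSize)) (+≤+ (maximum (cross X₁ X₂) crossFree))
  where
  k≥₁ : k₁ - + minDeg G₂ ≤ k
  k≥₁ = ℤP.≤-trans (ℤP.i≤i⊔j _ _) k≥
  k≥₂ : k₂ - + minDeg G₁ ≤ k
  k≥₂ = ℤP.≤-trans (ℤP.≤-trans (ℤP.i≤i⊔j _ _) (ℤP.i≤j⊔i (k₁ - + minDeg G₂) _)) k≥
  k≥min : (k₂ + + maxDeg G₁) ⊓ (k₁ + + maxDeg G₂) ≤ k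
  k≥min = ℤP.≤-trans (ℤP.≤-trans (ℤP.i≤j⊔i (k₂ - + minDeg G₁) _) (ℤP.i≤j⊔i (k₁ - + minDeg G₂) _)) k≥

  crossFree : IsOAF (G₁ □ G₂) k (cross X₁ X₂)
  crossFree = cross-oaf G₁ G₂ simple₁ simple₂ k₁ k₂ k k≥₁ k≥₂ k≥min X₁ X₂ free₁ free₂

  crossSize : count (cross X₁ X₂) ℕ.+ p₁ ℕ.* p₂ ≡ p₁ ℕ.* n G₂ ℕ.+ n G₁ ℕ.* p₂
  crossSize = subst₂ (λ c₁ c₂ → count (cross X₁ X₂) ℕ.+ c₁ ℕ.* c₂ ≡ c₁ ℕ.* n G₂ ℕ.+ n G₁ ℕ.* c₂)
                     |X₁|≡p₁ |X₂|≡p₂ (count-cross X₁ X₂)
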